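{- Let $\mathcal{V}=(Q,T)$ be a $d$-dimensional VASS, $q,r\in Q$ and $u,v\in\mathbb{N}^d$. If $(q,u)\to_c^*(r,v)$, then there is $w\in\mathbb{N}^d$ with $w\ge v$ (componentwise) such that $(q,u)\to^*(r,w)$.
   Context: A $d$-dimensional VASS is a pair $\mathcal{V}=(Q,T)$ with $Q$ a finite set of states and $T\subseteq Q\times\mathbb{Z}^d\times Q$ a finite set of rules. Configurations are pairs $(q,u)\in Q\times\mathbb{N}^d$. $(q,u)\to(r,v)$ iff there is a rule $(q,a,r)\in T$ with $v=u+a$ (with $v\in\mathbb{N}^d$); $\to^*$ is the reflexive-transitive closure. $(q,u)\to_c(r,v)$ iff $(q,u)\to(r,v)$, or $q=r$ and there are $1\le i\le d$ and $w\in\mathbb{N}^d$ with $u=w+2\mathbf{e}_i$ and $v=w+\mathbf{e}_i$ ($\mathbf{e}_i$ the $i$-th unit vector); $\to_c^*$ is its reflexive-transitive closure. -}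

module Defs where

open import Data.Nat using (ℕ; _≤_)
import Data.Nat
open import Data.Integer using (ℤ; +_; _+_)
open import Data.Fin using (Fin)
open import Data.Vec using (Vec; map; zipWith; _[_]≔_; lookup; replicate)
open import Data.Vec.Relation.Binary.Pointwise.Inductive using (Pointwise)
open import Data.List using (List)
open import Data.List.Membership.Propositional using (_∈_)
open import Data.Product using (_×_; _,_; Σ; ∃; ∃-syntax)
open import Data.Sum using (_⊎_)
open import Relation.Binary.PropositionalEquality using (_≡_)
open import Relation.Binary.Construct.Closure.ReflexiveTransitive using (Star)

record VASS (d : ℕ) : Set where
  field
    nStates : ℕ
    rules   : List (Fin nStates × Vec ℤ d × Fin nStates)

module _ {d : ℕ} (V : VASS d) where
  open VASS V

  State : Set
  State = Fin nStates

  Config : Set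
  Config = State × Vec ℕ d

  toℤ : Vec ℕ d → Vec ℤ d
  toℤ = map (λ n → + n)

  data Step : Config → Config → Set where
    step : ∀ {q r u v} (a : Vec ℤ d) → (q , a , r) ∈ rules →
           toℤ v ≡ zipWith _+_ (toℤ u) a → Step (q , u) (r , v)

  -- the coverability-style step →_c: a normal step, or decrementing a
  -- counter that is at least 2 by one (u = w + 2e_i, v = w + e_i)
  data StepC : Config → Config → Set where
    normal : ∀ {c c'} → Step c c' → StepC c c'
    halve  : ∀ {q} (i : Fin d) (w : Vec ℕ d) →
             StepC (q , zipWith Data.Nat._+_ w (replicate d 0 [ i ]≔ 2))
                   (q , zipWith Data.Nat._+_ w (replicate d 0 [ i ]≔ 1))

  Reach : Config → Config → Set
  Reach = Star Step

  ReachC : Config → Config → Set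
  ReachC = Star StepC

_≤ᵥ_ : ∀ {d} → Vec ℕ d → Vec ℕ d → Set
u ≤ᵥ v = Pointwise _≤_ u v

{-# OPTIONS --safe #-}
module Submission where

-- A halving step only lowers a counter, and VASS steps are
-- monotone (a rule enabled at u is enabled at every u' ≥ u, and the gap is
-- preserved).  So replay the ordinary steps of a →_c-run from a configuration
-- that dominates the current one and simply skip the halving steps; the
-- replayed configuration keeps dominating the original one.

open import Defs
open import Data.Nat using (ℕ; _∸_; _≤_; z≤n; s≤s) renaming (_+_ to _+ℕ_)
open import Data.Nat.Properties using (m≤n+m; m∸n+n≡m; ≤-refl; ≤-trans; +-monoʳ-≤)
open import Data.Integer using (ℤ; +_; _+_)
open import Data.Integer.Properties using (pos-+; +-assoc)
open import Data.Fin using (Fin; zero; suc)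
open import Data.Vec using (Vec; []; _∷_; map; zipWith; _[_]≔_; replicate)
open import Data.Vec.Properties using (∷-injective)
open import Data.Vec.Relation.Binary.Pointwise.Inductive as Pointwise using ([]; _∷_)
open import Data.Product using (Σ; _×_; _,_; proj₁; proj₂)
open import Relation.Binary.PropositionalEquality using (_≡_; refl; cong; cong₂; sym; module ≡-Reasoning)
open import Relation.Binary.Construct.Closure.ReflexiveTransitive using (ε; _◅_)

≤ᵥ-refl : ∀ {d} {u : Vec ℕ d} → u ≤ᵥ u
≤ᵥ-refl = Pointwise.refl ≤-refl

≤ᵥ-trans : ∀ {d} {u v w : Vec ℕ d} → u ≤ᵥ v → v ≤ᵥ w → u ≤ᵥ w
≤ᵥ-trans = Pointwise.trans ≤-trans

halve-≤ᵥ : ∀ {d} (i : Fin d) (w : Vec ℕ d) →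
           zipWith _+ℕ_ w (replicate d 0 [ i ]≔ 1) ≤ᵥ zipWith _+ℕ_ w (replicate d 0 [ i ]≔ 2)
halve-≤ᵥ zero    (x ∷ w) = +-monoʳ-≤ x (s≤s z≤n) ∷ ≤ᵥ-refl
halve-≤ᵥ (suc i) (x ∷ w) = ≤-refl ∷ halve-≤ᵥ i w

pos-+-lift : ∀ {x u u' : ℕ} {a : ℤ} → u ≤ u' → + x ≡ + u + a →
             + ((u' ∸ u) +ℕ x) ≡ + u' + a
pos-+-lift {x} {u} {u'} {a} u≤u' x≡u+a = begin
  + ((u' ∸ u) +ℕ x)        ≡⟨ pos-+ (u' ∸ u) x ⟩
  + (u' ∸ u) + + x         ≡⟨ cong (λ y → + (u' ∸ u) + y) x≡u+a ⟩
  + (u' ∸ u) + (+ u + a)   ≡⟨ sym (+-assoc (+ (u' ∸ u)) (+ u) a) ⟩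
  + (u' ∸ u) + + u + a     ≡⟨ cong (_+ a) (sym (pos-+ (u' ∸ u) u)) ⟩
  + ((u' ∸ u) +ℕ u) + a    ≡⟨ cong (λ n → + n + a) (m∸n+n≡m u≤u') ⟩
  + u' + a                 ∎
  where open ≡-Reasoning

+ᵥ-lift : ∀ {d} {x u u' : Vec ℕ d} {a : Vec ℤ d} → u ≤ᵥ u' →
          map +_ x ≡ zipWith _+_ (map +_ u) a →
          Σ (Vec ℕ d) (λ x' → (x ≤ᵥ x') × (map +_ x' ≡ zipWith _+_ (map +_ u') a))
+ᵥ-lift {x = []} {a = []} [] refl = [] , [] , refl
+ᵥ-lift {x = x ∷ xs} {u ∷ us} {u' ∷ us'} {a ∷ as} (u≤u' ∷ us≤us') eq
  with ∷-injective eq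
... | x≡u+a , xs≡us+as with +ᵥ-lift us≤us' xs≡us+as
...   | xs' , xs≤xs' , xs'≡us'+as =
  (u' ∸ u) +ℕ x ∷ xs' , m≤n+m x (u' ∸ u) ∷ xs≤xs' , cong₂ _∷_ (pos-+-lift {a = a} u≤u' x≡u+a) xs'≡us'+as

Step-monotone : ∀ {d} (V : VASS d) {q r : State V} {u u' v : Vec ℕ d} →
                Step V (q , u) (r , v) → u ≤ᵥ u' →
                Σ (Vec ℕ d) (λ v' → (v ≤ᵥ v') × Step V (q , u') (r , v'))
Step-monotone V (step a a∈rules v≡u+a) u≤u'
  with +ᵥ-lift u≤u' v≡u+a
... | v' , v≤v' , v'≡u'+a = v' , v≤v' , step a a∈rules v'≡u'+a

ReachC⇒covered-Reach : ∀ {d} (V : VASS d) {c c' : Config V} → ReachC V c c' →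
                       ∀ {u'} → proj₂ c ≤ᵥ u' →
                       Σ (Vec ℕ d) (λ w → (proj₂ c' ≤ᵥ w) × Reach V (proj₁ c , u') (proj₁ c' , w))
ReachC⇒covered-Reach V ε {u'} u≤u' = u' , u≤u' , ε
ReachC⇒covered-Reach V (normal s ◅ run) u≤u'
  with Step-monotone V s u≤u'
... | v' , v≤v' , s' with ReachC⇒covered-Reach V run v≤v'
...   | w , covered , run' = w , covered , s' ◅ run'
ReachC⇒covered-Reach V (halve i w ◅ run) u≤u' =
  ReachC⇒covered-Reach V run (≤ᵥ-trans (halve-≤ᵥ i w) u≤u')

lemma22 : (d : ℕ) (V : VASS d) (q r : State V) (u v : Vec ℕ d) →
          ReachC V (q , u) (r , v) →
          Σ (Vec ℕ d) (λ w → (v ≤ᵥ w) × Reach V (q , u) (r , w))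
lemma22 d V q r u v run = ReachC⇒covered-Reach V run ≤ᵥ-refl
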